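{- Let $\Gamma$ be a finite, simple, connected graph and let $G\leq\mathrm{Aut}(\Gamma)$ be such that $\Gamma$ is $G$-arc-transitive. If $G$ has a normal semiregular subgroup with at most two orbits on the vertices of $\Gamma$, then the subgroup of $G$ fixing a vertex and all of its neighbours is trivial.
   Context: $\Gamma$ is $G$-arc-transitive if $G$ acts transitively on the ordered pairs of adjacent vertices. A permutation group is semiregular if its only element fixing a point is the identity. -}

module Defs where

open import Data.Nat using (ℕ)
open import Data.Fin using (Fin)
open import Data.Fin.Permutation using (Permutation′; _⟨$⟩ʳ_; _≈_; id; flip; _∘ₚ_)
open import Data.Product using (Σ; ∃; _×_; _,_)
open import Data.Sum using (_⊎_)
open import Relation.Binary.PropositionalEquality using (_≡_)
open import Relation.Binary.Construct.Closure.ReflexiveTransitive using (Star)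
open import Relation.Nullary using (¬_)

record Graph (n : ℕ) : Set₁ where
  field
    Adj    : Fin n → Fin n → Set
    sym    : ∀ {u v} → Adj u v → Adj v u
    irrefl : ∀ {v} → ¬ Adj v v

open Graph public

Connected : ∀ {n} → Graph n → Set
Connected Γ = ∀ u v → Star (Adj Γ) u v

Perm : ℕ → Set
Perm n = Permutation′ n

PermSet : ℕ → Set₁
PermSet n = Perm n → Set

record IsSubgroup {n : ℕ} (H : PermSet n) : Set where
  field
    respects : ∀ {g h} → g ≈ h → H g → H h
    has-id   : H id
    has-∘    : ∀ {g h} → H g → H h → H (g ∘ₚ h)
    has-inv  : ∀ {g} → H g → H (flip g)

IsAut : ∀ {n} → Graph n → Perm n → Set
IsAut Γ g = ∀ u v → (Adj Γ u v → Adj Γ (g ⟨$⟩ʳ u) (g ⟨$⟩ʳ v))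
                  × (Adj Γ (g ⟨$⟩ʳ u) (g ⟨$⟩ʳ v) → Adj Γ u v)

IsAutSubgroup : ∀ {n} → Graph n → PermSet n → Set
IsAutSubgroup Γ G = IsSubgroup G × (∀ g → G g → IsAut Γ g)

_⊆_ : ∀ {n} → PermSet n → PermSet n → Set
N ⊆ G = ∀ g → N g → G g

ArcTransitive : ∀ {n} → Graph n → PermSet n → Set
ArcTransitive Γ G = ∀ u v x y → Adj Γ u v → Adj Γ x y →
  Σ (Perm _) λ g → G g × (g ⟨$⟩ʳ u ≡ x) × (g ⟨$⟩ʳ v ≡ y)

IsNormalSubgroup : ∀ {n} → PermSet n → PermSet n → Set
IsNormalSubgroup N G = IsSubgroup N × N ⊆ G ×
  (∀ g h → G g → N h → N (flip g ∘ₚ h ∘ₚ g))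

Semiregular : ∀ {n} → PermSet n → Set
Semiregular {n} N = ∀ h → N h → ∀ (v : Fin n) → h ⟨$⟩ʳ v ≡ v → h ≈ id

SameOrbit : ∀ {n} → PermSet n → Fin n → Fin n → Set
SameOrbit N u v = Σ (Perm _) λ h → N h × (h ⟨$⟩ʳ u ≡ v)

AtMostTwoOrbits : ∀ {n} → PermSet n → Set
AtMostTwoOrbits {n} N = ∀ (u v w : Fin n) →
  SameOrbit N u v ⊎ SameOrbit N u w ⊎ SameOrbit N v w

FixesVertexAndNeighbours : ∀ {n} → Graph n → Fin n → Perm n → Set
FixesVertexAndNeighbours Γ v g =
  (g ⟨$⟩ʳ v ≡ v) × (∀ w → Adj Γ v w → g ⟨$⟩ʳ w ≡ w)

module Submission where

-- Let g ∈ G fix a vertex v and all its neighbours; call a vertex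
-- x "g-rigid" when g fixes x and every neighbour of x.  Since Γ is connected
-- it suffices to show that rigidity spreads along edges: then every vertex is
-- rigid and g is the identity.
--
-- The engine is a centraliser argument: if s ∈ N and g fixes both p and s p,
-- then the commutator g s g⁻¹ s⁻¹ lies in the normal subgroup N and fixes s p,
-- so by semiregularity it is trivial, i.e. g commutes with s.  A permutation
-- commuting with an automorphism s carries fixed points, and rigid vertices,
-- from x to s x.  Given a rigid x, an edge x ~ y and a neighbour z of y, two of
-- x, y, z share an N-orbit:
--   * x ~N~ y : g commutes with the s ∈ N sending x to y, so y is rigid;
--   * x ~N~ z : with s x = z, g fixes y and s⁻¹ y (a neighbour of x), hence
--               commutes with s⁻¹, hence with s, and so fixes z = s x;
--   * y ~N~ z : an arc-transitive a ∈ G sending (y , z) to (x , y) conjugates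
--               this to x ~N~ y, the first case.

open import Defs hiding (sym)
open import Data.Nat using (ℕ)
open import Data.Fin using (Fin)
open import Data.Fin.Permutation using (_≈_; id; flip; _∘ₚ_; _⟨$⟩ʳ_; _⟨$⟩ˡ_; inverseˡ; inverseʳ)
open import Data.Product using (Σ; _×_; _,_; proj₁; proj₂)
open import Data.Sum using (inj₁; inj₂)
open import Relation.Binary.PropositionalEquality using (_≡_; sym; trans; cong; subst; subst₂; module ≡-Reasoning)
open import Relation.Binary.Construct.Closure.ReflexiveTransitive using (Star; ε; _◅_)

open ≡-Reasoning

Commute : ∀ {n} → Perm n → Perm n → Set
Commute g s = ∀ q → g ⟨$⟩ʳ (s ⟨$⟩ʳ q) ≡ s ⟨$⟩ʳ (g ⟨$⟩ʳ q)

commute-flip : ∀ {n} (g s : Perm n) → Commute g (flip s) → Commute g s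
commute-flip g s c q = begin
  g ⟨$⟩ʳ (s ⟨$⟩ʳ q)                          ≡⟨ sym (inverseʳ s) ⟩
  s ⟨$⟩ʳ (s ⟨$⟩ˡ (g ⟨$⟩ʳ (s ⟨$⟩ʳ q)))        ≡⟨ cong (s ⟨$⟩ʳ_) (sym (c (s ⟨$⟩ʳ q))) ⟩
  s ⟨$⟩ʳ (g ⟨$⟩ʳ (s ⟨$⟩ˡ (s ⟨$⟩ʳ q)))        ≡⟨ cong (λ r → s ⟨$⟩ʳ (g ⟨$⟩ʳ r)) (inverseˡ s) ⟩
  s ⟨$⟩ʳ (g ⟨$⟩ʳ q)                          ∎

commute-fixed : ∀ {n} (g s : Perm n) → Commute g s →
  ∀ {p} → g ⟨$⟩ʳ p ≡ p → g ⟨$⟩ʳ (s ⟨$⟩ʳ p) ≡ s ⟨$⟩ʳ p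
commute-fixed g s c {p} gp = trans (c p) (cong (s ⟨$⟩ʳ_) gp)

fixed-inverse : ∀ {n} (g : Perm n) {p} → g ⟨$⟩ʳ p ≡ p → g ⟨$⟩ˡ p ≡ p
fixed-inverse g {p} gp = trans (cong (g ⟨$⟩ˡ_) (sym gp)) (inverseˡ g)

aut-inverse : ∀ {n} (Γ : Graph n) (s : Perm n) → IsAut Γ s →
  ∀ {u v} → Adj Γ u v → Adj Γ (s ⟨$⟩ˡ u) (s ⟨$⟩ˡ v)
aut-inverse Γ s s-aut {u} {v} uv =
  proj₂ (s-aut (s ⟨$⟩ˡ u) (s ⟨$⟩ˡ v)) (subst₂ (Adj Γ) (sym (inverseʳ s)) (sym (inverseʳ s)) uv)

commute-rigid : ∀ {n} (Γ : Graph n) (g s : Perm n) → IsAut Γ s → Commute g s →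
  ∀ {x} → FixesVertexAndNeighbours Γ x g → FixesVertexAndNeighbours Γ (s ⟨$⟩ʳ x) g
commute-rigid Γ g s s-aut c {x} (gx , gnbrs) = commute-fixed g s c gx , fixes-nbrs
  where
  fixes-nbrs : ∀ w → Adj Γ (s ⟨$⟩ʳ x) w → g ⟨$⟩ʳ w ≡ w
  fixes-nbrs w sx~w = begin
    g ⟨$⟩ʳ w                    ≡⟨ cong (g ⟨$⟩ʳ_) (sym (inverseʳ s)) ⟩
    g ⟨$⟩ʳ (s ⟨$⟩ʳ (s ⟨$⟩ˡ w))  ≡⟨ commute-fixed g s c (gnbrs _ x~s⁻¹w) ⟩
    s ⟨$⟩ʳ (s ⟨$⟩ˡ w)           ≡⟨ inverseʳ s ⟩
    w                           ∎
    where
    x~s⁻¹w : Adj Γ x (s ⟨$⟩ˡ w)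
    x~s⁻¹w = subst (λ u → Adj Γ u (s ⟨$⟩ˡ w)) (inverseˡ s) (aut-inverse Γ s s-aut sx~w)

module NormalSubgroup {n : ℕ} {G N : PermSet n} (normal : IsNormalSubgroup N G) where

  open IsSubgroup (proj₁ normal)

  conjugate : ∀ a s → G a → N s → N (flip a ∘ₚ s ∘ₚ a)
  conjugate = proj₂ (proj₂ normal)

  orbit-conjugate : ∀ {a u w} → G a → SameOrbit N u w →
    SameOrbit N (a ⟨$⟩ʳ u) (a ⟨$⟩ʳ w)
  orbit-conjugate {a} {u} {w} Ga (s , Ns , su≡w) =
    flip a ∘ₚ s ∘ₚ a , conjugate a s Ga Ns , (begin
      a ⟨$⟩ʳ (s ⟨$⟩ʳ (a ⟨$⟩ˡ (a ⟨$⟩ʳ u)))  ≡⟨ cong (λ r → a ⟨$⟩ʳ (s ⟨$⟩ʳ r)) (inverseˡ a) ⟩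
      a ⟨$⟩ʳ (s ⟨$⟩ʳ u)                    ≡⟨ cong (a ⟨$⟩ʳ_) su≡w ⟩
      a ⟨$⟩ʳ w                             ∎)

  -- Centraliser lemma: if N is semiregular, g ∈ G and s ∈ N, and g fixes
  -- both p and s p, then g commutes with s.  The commutator g s g⁻¹ s⁻¹ lies
  -- in N and fixes s p, so it is the identity.
  fixing-commutes : Semiregular N → ∀ g s → G g → N s →
    ∀ {p} → g ⟨$⟩ʳ p ≡ p → g ⟨$⟩ʳ (s ⟨$⟩ʳ p) ≡ s ⟨$⟩ʳ p → Commute g s
  fixing-commutes semireg g s Gg Ns {p} gp gsp q = begin
    g ⟨$⟩ʳ (s ⟨$⟩ʳ q)                                          ≡⟨ cong (λ r → g ⟨$⟩ʳ (s ⟨$⟩ʳ r)) (sym (inverseˡ g)) ⟩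
    g ⟨$⟩ʳ (s ⟨$⟩ʳ (g ⟨$⟩ˡ (g ⟨$⟩ʳ q)))                        ≡⟨ cong (λ r → g ⟨$⟩ʳ (s ⟨$⟩ʳ (g ⟨$⟩ˡ r))) (sym (inverseˡ s)) ⟩
    commutator ⟨$⟩ʳ (s ⟨$⟩ʳ (g ⟨$⟩ʳ q))                       ≡⟨ trivial (s ⟨$⟩ʳ (g ⟨$⟩ʳ q)) ⟩
    s ⟨$⟩ʳ (g ⟨$⟩ʳ q)                                          ∎
    where
    commutator : Perm n
    commutator = flip s ∘ₚ (flip g ∘ₚ s ∘ₚ g)

    commutator-fixes : commutator ⟨$⟩ʳ (s ⟨$⟩ʳ p) ≡ s ⟨$⟩ʳ p
    commutator-fixes = begin
      g ⟨$⟩ʳ (s ⟨$⟩ʳ (g ⟨$⟩ˡ (s ⟨$⟩ˡ (s ⟨$⟩ʳ p))))  ≡⟨ cong (λ r → g ⟨$⟩ʳ (s ⟨$⟩ʳ (g ⟨$⟩ˡ r))) (inverseˡ s) ⟩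
      g ⟨$⟩ʳ (s ⟨$⟩ʳ (g ⟨$⟩ˡ p))                    ≡⟨ cong (λ r → g ⟨$⟩ʳ (s ⟨$⟩ʳ r)) (fixed-inverse g gp) ⟩
      g ⟨$⟩ʳ (s ⟨$⟩ʳ p)                             ≡⟨ gsp ⟩
      s ⟨$⟩ʳ p                                      ∎

    trivial : commutator ≈ id
    trivial = semireg commutator (has-∘ (has-inv Ns) (conjugate g s Gg Ns)) (s ⟨$⟩ʳ p) commutator-fixes

module Propagation {n : ℕ} (Γ : Graph n) {G N : PermSet n}
  (autG : IsAutSubgroup Γ G) (arcTrans : ArcTransitive Γ G)
  (normal : IsNormalSubgroup N G) (semireg : Semiregular N) (twoOrbits : AtMostTwoOrbits N)
  {g : Perm n} (Gg : G g) where

  open NormalSubgroup normal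
  open IsSubgroup (proj₁ normal) using (has-inv)

  aut : ∀ {s} → N s → IsAut Γ s
  aut {s} Ns = proj₂ autG s (proj₁ (proj₂ normal) s Ns)

  Rigid : Fin n → Set
  Rigid x = FixesVertexAndNeighbours Γ x g

  -- Case x ~N~ y: the element of N sending x to y commutes with g.
  rigid-along-orbit : ∀ {x y} → Rigid x → g ⟨$⟩ʳ y ≡ y → SameOrbit N x y → Rigid y
  rigid-along-orbit (gx , gnbrs) gy (s , Ns , sx≡y) =
    subst Rigid sx≡y (commute-rigid Γ g s (aut Ns) commutes (gx , gnbrs))
    where
    commutes : Commute g s
    commutes = fixing-commutes semireg g s Gg Ns gx (trans (cong (g ⟨$⟩ʳ_) sx≡y) (trans gy (sym sx≡y)))

  -- Case x ~N~ z: with s x = z, g fixes y and the neighbour s⁻¹ y of x, so it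
  -- commutes with s⁻¹, hence with s, and fixes z = s x.
  fixed-via-orbit : ∀ {x y z} → Rigid x → g ⟨$⟩ʳ y ≡ y → Adj Γ y z →
    SameOrbit N x z → g ⟨$⟩ʳ z ≡ z
  fixed-via-orbit {x} {y} (gx , gnbrs) gy y~z (s , Ns , sx≡z) =
    subst (λ w → g ⟨$⟩ʳ w ≡ w) sx≡z (commute-fixed g s (commute-flip g s commutes) gx)
    where
    x~s⁻¹y : Adj Γ x (s ⟨$⟩ˡ y)
    x~s⁻¹y = subst (λ u → Adj Γ u (s ⟨$⟩ˡ y)) (inverseˡ s)
               (aut-inverse Γ s (aut Ns) (subst (λ w → Adj Γ w y) (sym sx≡z) (Graph.sym Γ y~z)))

    commutes : Commute g (flip s)
    commutes = fixing-commutes semireg g (flip s) Gg (has-inv Ns) gy (gnbrs _ x~s⁻¹y)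

  -- Case y ~N~ z: an element of G sending the arc (y , z) to (x , y)
  -- conjugates this orbit relation to x ~N~ y.
  orbit-shift : ∀ {x y z} → Adj Γ x y → Adj Γ y z → SameOrbit N y z → SameOrbit N x y
  orbit-shift {x} {y} {z} x~y y~z yz-orbit with arcTrans y z x y y~z x~y
  ... | a , Ga , ay≡x , az≡y = subst₂ (SameOrbit N) ay≡x az≡y (orbit-conjugate Ga yz-orbit)

  rigid-step : ∀ {x y} → Rigid x → Adj Γ x y → Rigid y
  rigid-step {x} {y} (gx , gnbrs) x~y = gy , fixes-nbrs
    where
    gy : g ⟨$⟩ʳ y ≡ y
    gy = gnbrs y x~y

    fixes-nbrs : ∀ z → Adj Γ y z → g ⟨$⟩ʳ z ≡ z
    fixes-nbrs z y~z with twoOrbits x y z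
    ... | inj₁ xy-orbit        = proj₂ (rigid-along-orbit (gx , gnbrs) gy xy-orbit) z y~z
    ... | inj₂ (inj₁ xz-orbit) = fixed-via-orbit (gx , gnbrs) gy y~z xz-orbit
    ... | inj₂ (inj₂ yz-orbit) =
      proj₂ (rigid-along-orbit (gx , gnbrs) gy (orbit-shift x~y y~z yz-orbit)) z y~z

  rigid-walk : ∀ {x u} → Rigid x → Star (Adj Γ) x u → Rigid u
  rigid-walk rx ε          = rx
  rigid-walk rx (x~y ◅ ys) = rigid-walk (rigid-step rx x~y) ys

lemma4p6 : (n : ℕ) (Γ : Graph n) → Connected Γ →
    (G : PermSet n) → IsAutSubgroup Γ G → ArcTransitive Γ G →
    (Σ (PermSet n) λ N → IsNormalSubgroup N G × Semiregular N × AtMostTwoOrbits N) →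
    ∀ (v : Fin n) (g : Perm n) → G g → FixesVertexAndNeighbours Γ v g → g ≈ id
lemma4p6 n Γ connected G autG arcTrans (N , normal , semireg , twoOrbits) v g Gg rigid-v u =
  proj₁ (rigid-walk rigid-v (connected v u))
  where open Propagation Γ autG arcTrans normal semireg twoOrbits Gg
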